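{- Let $G$ be a graph and $H$ a proper subgraph of $G$. If $v\in V(G)\setminus V(H)$ has degree three in $G$, then every $v$-stamen in $(G,H)$ is a reducible configuration of $(G,H)$.
   Context: A path $P\subseteq G$ is a stamen in $(G,H)$ if it has an end $u\in V(G)\setminus V(H)$ with degree exactly three in $G$ and every internal (non-end) vertex of $P$ has degree exactly four in $G$ and is not in $H$; if $v\ne u$ is the other end of $P$, $P$ is a $v$-stamen. A reducible configuration of $(G,H)$ is a nonempty subgraph $Q$ of $G-V(H)$ such that for every list-assignment $L$ of $G$ with $|L(v)|\ge 4$ for all $v$, every $L$-coloring of $G-V(Q)$ extends to at least two distinct $L$-colorings of $G$ (an $L$-coloring being a map $\phi$ with $\phi(v)\in L(v)$ and $\phi(u)\ne\phi(v)$ for adjacent $u,v$). -}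

module Defs where

open import Data.Nat using (ℕ; _≤_)
open import Data.Bool using (Bool; true; false; if_then_else_)
open import Data.Fin using (Fin)
open import Data.List using (List; []; _∷_; _++_; length; map; allFin)
open import Data.Nat.ListAction using (sum)
open import Data.List.Membership.Propositional using (_∈_)
open import Data.List.Relation.Unary.All using (All)
open import Data.List.Relation.Unary.Unique.Propositional using (Unique)
open import Data.List.Relation.Unary.Linked using (Linked; [-]; _∷_)
open import Data.List.Relation.Unary.Any using (here; there)
open import Data.Product using (Σ; ∃; ∃-syntax; _×_; _,_)
open import Data.Sum using (_⊎_; inj₁; inj₂)
open import Data.Unit using (⊤)
open import Relation.Nullary using (¬_)
open import Relation.Binary.PropositionalEquality using (_≡_; _≢_; refl)

record Graph (n : ℕ) : Set where
  field
    adj    : Fin n → Fin n → Bool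
    sym    : ∀ x y → adj x y ≡ adj y x
    irrefl : ∀ x → adj x x ≡ false
open Graph public

Edge : ∀ {n} → Graph n → Fin n → Fin n → Set
Edge G x y = adj G x y ≡ true

degree : ∀ {n} → Graph n → Fin n → ℕ
degree {n} G x = sum (map (λ y → if adj G x y then 1 else 0) (allFin n))

record Subgraph {n : ℕ} (G : Graph n) : Set₁ where
  field
    V     : Fin n → Set
    E     : Fin n → Fin n → Set
    E-sym : ∀ {x y} → E x y → E y x
    E⊆G   : ∀ {x y} → E x y → Edge G x y
    E-end : ∀ {x y} → E x y → V x × V y
open Subgraph public

Proper : ∀ {n} {G : Graph n} → Subgraph G → Set
Proper {n} {G} H = ¬ ((∀ x → V H x) × (∀ x y → Edge G x y → E H x y))

IsPath : ∀ {n} → Graph n → List (Fin n) → Set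
IsPath G xs = Unique xs × Linked (Edge G) xs

data Consec {n : ℕ} : List (Fin n) → Fin n → Fin n → Set where
  here  : ∀ {x y xs} → Consec (x ∷ y ∷ xs) x y
  there : ∀ {z xs x y} → Consec xs x y → Consec (z ∷ xs) x y

private
  consec-edge : ∀ {n} (G : Graph n) {xs x y} → Linked (Edge G) xs → Consec xs x y → Edge G x y
  consec-edge G (e ∷ _) here = e
  consec-edge G (_ ∷ l) (there c) = consec-edge G l c
  consec-edge G [-] (there ())

  consec-mem : ∀ {n} {xs : List (Fin n)} {x y} → Consec xs x y → (x ∈ xs) × (y ∈ xs)
  consec-mem here = here refl , there (here refl)
  consec-mem (there c) with consec-mem c
  ... | a , b = there a , there b

  sym-edge : ∀ {n} (G : Graph n) {x y} → Edge G x y → Edge G y x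
  sym-edge G {x} {y} e rewrite sym G y x = e

  swap⊎ : ∀ {A B : Set} → A ⊎ B → B ⊎ A
  swap⊎ (inj₁ a) = inj₂ a
  swap⊎ (inj₂ b) = inj₁ b

pathSubgraph : ∀ {n} (G : Graph n) (xs : List (Fin n)) → IsPath G xs → Subgraph G
pathSubgraph G xs (_ , l) = record
  { V     = λ x → x ∈ xs
  ; E     = λ x y → Consec xs x y ⊎ Consec xs y x
  ; E-sym = swap⊎
  ; E⊆G   = λ { (inj₁ c) → consec-edge G l c ; (inj₂ c) → sym-edge G (consec-edge G l c) }
  ; E-end = λ { (inj₁ c) → consec-mem c
              ; (inj₂ c) → let (a , b) = consec-mem c in b , a }
  }

-- A v-stamen in (G,H): a path u, mid..., v with u ∉ V(H), deg u = 3,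
-- every internal vertex of degree 4 and not in H. (u ≠ v by Unique.)
record Stamen {n : ℕ} (G : Graph n) (H : Subgraph G) (v : Fin n) : Set where
  field
    u        : Fin n
    mid      : List (Fin n)
    isPath   : IsPath G (u ∷ mid ++ v ∷ [])
    u∉H      : ¬ V H u
    deg-u    : degree G u ≡ 3
    internal : All (λ x → degree G x ≡ 4 × ¬ V H x) mid
open Stamen public

stamenVerts : ∀ {n} {G : Graph n} {H : Subgraph G} {v} → Stamen G H v → List (Fin n)
stamenVerts {v = v} P = u P ∷ mid P ++ v ∷ []

stamenSubgraph : ∀ {n} {G : Graph n} {H : Subgraph G} {v} → Stamen G H v → Subgraph G
stamenSubgraph {G = G} P = pathSubgraph G (stamenVerts P) (isPath P)

ListAssignment : ℕ → Set
ListAssignment n = Fin n → List ℕ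

AtLeast4 : ∀ {n} → ListAssignment n → Set
AtLeast4 L = ∀ x → Unique (L x) × (4 ≤ length (L x))

IsLColoring : ∀ {n} → Graph n → ListAssignment n → (Fin n → Set) → (Fin n → ℕ) → Set
IsLColoring G L S φ =
  (∀ x → S x → φ x ∈ L x) × (∀ x y → S x → S y → Edge G x y → φ x ≢ φ y)

ReducibleConfiguration : ∀ {n} (G : Graph n) → Subgraph G → Subgraph G → Set
ReducibleConfiguration {n} G H Q =
  (∃[ x ] V Q x)
  × (∀ x → V Q x → ¬ V H x)
  × (∀ (L : ListAssignment n) → AtLeast4 L →
     ∀ (φ : Fin n → ℕ) → IsLColoring G L (λ x → ¬ V Q x) φ →
     ∃[ ψ₁ ] ∃[ ψ₂ ]
       IsLColoring G L (λ _ → ⊤) ψ₁ × IsLColoring G L (λ _ → ⊤) ψ₂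
       × (∀ x → ¬ V Q x → ψ₁ x ≡ φ x) × (∀ x → ¬ V Q x → ψ₂ x ≡ φ x)
       × (∃[ x ] ψ₁ x ≢ ψ₂ x))

-- The stamen is coloured greedily from its degree-three end u towards v. Every vertex
-- except v still has its successor on the path uncoloured when its turn comes, so it
-- sees at most deg − 1 coloured neighbours: one or more of its four colours is free,
-- and at u (degree three) two are. The final vertex v has degree three, so a colour
-- is free for it too. The two choices at u give two distinct extensions.
module Submission where

open import Defs hiding (sym)
open import Data.Bool using (Bool; true; false; if_then_else_)
import Data.Bool as Bool
open import Data.Fin using (Fin)
import Data.Fin as Fin
open import Data.List using (List; []; _∷_; _++_; length; map; filter; allFin)
open import Data.List.Properties using (length-filter; filter-notAll; length-map)
open import Data.List.Membership.Propositional using (_∈_; _∉_; lose)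
open import Data.List.Membership.Propositional.Properties
  using (∈-filter⁺; ∈-map⁺; ∈-allFin)
import Data.List.Membership.DecPropositional as DecMembership
open import Data.List.Relation.Unary.All using (All; []; _∷_)
import Data.List.Relation.Unary.All as All
open import Data.List.Relation.Unary.All.Properties using (All¬⇒¬Any; ++⁺)
open import Data.List.Relation.Unary.AllPairs using (_∷_)
open import Data.List.Relation.Unary.Any using (here; there)
open import Data.List.Relation.Unary.Linked using (Linked; _∷_)
import Data.List.Relation.Unary.Linked as Linked
open import Data.List.Relation.Unary.Unique.Propositional using (Unique)
open import Data.Nat using (ℕ; suc; _≤_; _<_; s≤s)
import Data.Nat as ℕ
open import Data.Nat.ListAction using (sum)
open import Data.Nat.Properties using (≤-trans; ≤-reflexive; ≤-pred; <-≤-trans; ≤-<-trans; n≤1+n)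
open import Data.Product using (∃; ∃-syntax; ∃₂; _×_; _,_; proj₁; proj₂)
open import Data.Sum using (_⊎_; inj₁; inj₂)
open import Data.Unit using (⊤; tt)
open import Function using (_∘_; const)
open import Data.Vec.Functional using (updateAt)
open import Data.Vec.Functional.Properties using (updateAt-updates; updateAt-minimal)
open import Relation.Binary.Definitions using (DecidableEquality)
open import Relation.Nullary using (¬_; yes; no; ¬?)
open import Relation.Binary.PropositionalEquality using (_≡_; _≢_; refl; sym; trans; subst; cong)

module _ {A : Set} (_≟_ : DecidableEquality A) where

  open DecMembership _≟_ using (_∈?_)

  freeColour : (cs fs : List A) → Unique cs → length fs < length cs →
               ∃[ c ] c ∈ cs × c ∉ fs
  freeColour (c ∷ cs) fs (c∉cs ∷ cs-unique) fs<cs with c ∈? fs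
  ... | no c∉fs = c , here refl , c∉fs
  ... | yes c∈fs
    with c′ , c′∈cs , c′∉fs′ ← freeColour cs (filter (¬? ∘ (_≟ c)) fs) cs-unique
           (<-≤-trans (filter-notAll (¬? ∘ (_≟ c)) fs (lose c∈fs λ c≢c → c≢c refl))
                      (≤-pred fs<cs))
    = c′ , there c′∈cs ,
      λ c′∈fs → c′∉fs′ (∈-filter⁺ (¬? ∘ (_≟ c)) c′∈fs
                          λ c′≡c → All.lookup c∉cs c′∈cs (sym c′≡c))

  twoFreeColours : (cs fs : List A) → Unique cs → suc (length fs) < length cs →
                   ∃₂ λ c₁ c₂ → c₁ ∈ cs × c₁ ∉ fs × c₂ ∈ cs × c₂ ∉ fs × c₁ ≢ c₂
  twoFreeColours cs fs cs-unique fs<cs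
    with c₁ , c₁∈cs , c₁∉fs ← freeColour cs fs cs-unique (≤-trans (s≤s (n≤1+n _)) fs<cs)
    with c₂ , c₂∈cs , c₂∉c₁fs ← freeColour cs (c₁ ∷ fs) cs-unique fs<cs
    = c₁ , c₂ , c₁∈cs , c₁∉fs , c₂∈cs , c₂∉c₁fs ∘ there , c₂∉c₁fs ∘ here ∘ sym

length-filter-≟true : ∀ {A : Set} (f : A → Bool) (xs : List A) →
  length (filter (λ x → f x Bool.≟ true) xs) ≡ sum (map (λ x → if f x then 1 else 0) xs)
length-filter-≟true f [] = refl
length-filter-≟true f (x ∷ xs) with f x
... | true  = cong suc (length-filter-≟true f xs)
... | false = length-filter-≟true f xs

module _ {n : ℕ} (G : Graph n) where

  open DecMembership (Fin._≟_ {n}) using (_∉?_)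

  edge-sym : ∀ {x y} → Edge G x y → Edge G y x
  edge-sym {x} {y} e = trans (Graph.sym G y x) e

  ¬loop : ∀ {x} → ¬ Edge G x x
  ¬loop {x} e with () ← trans (sym e) (irrefl G x)

  neighbours : Fin n → List (Fin n)
  neighbours x = filter (λ y → adj G x y Bool.≟ true) (allFin n)

  length-neighbours : ∀ x → length (neighbours x) ≡ degree G x
  length-neighbours x = length-filter-≟true (adj G x) (allFin n)

  edge⇒∈-neighbours : ∀ {x y} → Edge G x y → y ∈ neighbours x
  edge⇒∈-neighbours {x} {y} e = ∈-filter⁺ (λ y → adj G x y Bool.≟ true) (∈-allFin y) e

  colouredNeighbours : Fin n → List (Fin n) → List (Fin n)
  colouredNeighbours w ws = filter (_∉? ws) (neighbours w)

  length-colouredNeighbours-≤ : ∀ w ws → length (colouredNeighbours w ws) ≤ degree G w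
  length-colouredNeighbours-≤ w ws =
    ≤-trans (length-filter (_∉? ws) (neighbours w)) (≤-reflexive (length-neighbours w))

  length-colouredNeighbours-< : ∀ {w e} ws → e ∈ ws → Edge G w e →
                                length (colouredNeighbours w ws) < degree G w
  length-colouredNeighbours-< {w} ws e∈ws e =
    <-≤-trans (filter-notAll (_∉? ws) (neighbours w) (lose (edge⇒∈-neighbours e) λ e∉ws → e∉ws e∈ws))
              (≤-reflexive (length-neighbours w))

  module _ (L : ListAssignment n) where

    IsLColoring-mono : ∀ {S T : Fin n → Set} {ψ} → (∀ x → T x → S x) →
                       IsLColoring G L S ψ → IsLColoring G L T ψ
    IsLColoring-mono T⊆S (inL , proper) =
      (λ x → inL x ∘ T⊆S x) , λ x y Tx Ty → proper x y (T⊆S x Tx) (T⊆S y Ty)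

    colourVertex : ∀ {w ws ψ c} → w ∉ ws → IsLColoring G L (_∉ w ∷ ws) ψ →
                   c ∈ L w → c ∉ map ψ (colouredNeighbours w ws) →
                   IsLColoring G L (_∉ ws) (updateAt ψ w (const c))
    colourVertex {w} {ws} {ψ} {c} w∉ws (inL , proper) c∈L c-free = inL′ , proper′
      where
      ψ′ : Fin n → ℕ
      ψ′ = updateAt ψ w (const c)

      ψ′w≡c : ψ′ w ≡ c
      ψ′w≡c = updateAt-updates w ψ

      newOrOld : ∀ x → x ∉ ws → x ≡ w ⊎ (x ∉ w ∷ ws × ψ′ x ≡ ψ x)
      newOrOld x x∉ws with x Fin.≟ w
      ... | yes x≡w = inj₁ x≡w
      ... | no x≢w  = inj₂ ((λ { (here x≡w) → x≢w x≡w ; (there x∈ws) → x∉ws x∈ws })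
                           , updateAt-minimal x w ψ x≢w)

      c≢neighbour : ∀ y → y ∉ w ∷ ws → Edge G w y → c ≢ ψ y
      c≢neighbour y y∉ e c≡ψy = c-free (subst (_∈ map ψ (colouredNeighbours w ws)) (sym c≡ψy)
        (∈-map⁺ ψ (∈-filter⁺ (_∉? ws) (edge⇒∈-neighbours e) (y∉ ∘ there))))

      inL′ : ∀ x → x ∉ ws → ψ′ x ∈ L x
      inL′ x x∉ws with newOrOld x x∉ws
      ... | inj₁ refl          = subst (_∈ L w) (sym ψ′w≡c) c∈L
      ... | inj₂ (x∉ , ψ′x≡ψx) = subst (_∈ L x) (sym ψ′x≡ψx) (inL x x∉)

      proper′ : ∀ x y → x ∉ ws → y ∉ ws → Edge G x y → ψ′ x ≢ ψ′ y
      proper′ x y x∉ws y∉ws e with newOrOld x x∉ws | newOrOld y y∉ws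
      ... | inj₁ refl | inj₁ refl = λ _ → ¬loop e
      ... | inj₁ refl | inj₂ (y∉ , ψ′y≡ψy) =
        λ same → c≢neighbour y y∉ e (trans (sym ψ′w≡c) (trans same ψ′y≡ψy))
      ... | inj₂ (x∉ , ψ′x≡ψx) | inj₁ refl =
        λ same → c≢neighbour x x∉ (edge-sym e) (trans (sym ψ′w≡c) (trans (sym same) ψ′x≡ψx))
      ... | inj₂ (x∉ , ψ′x≡ψx) | inj₂ (y∉ , ψ′y≡ψy) =
        λ same → proper x y x∉ y∉ e (trans (sym ψ′x≡ψx) (trans same ψ′y≡ψy))

    Extends : (Fin n → ℕ) → List (Fin n) → (Fin n → ℕ) → Set
    Extends φ ws ψ = IsLColoring G L (λ _ → ⊤) ψ × (∀ x → x ∉ ws → ψ x ≡ φ x)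

    GreedyOrder : List (Fin n) → Set
    GreedyOrder []       = ⊤
    GreedyOrder (w ∷ ws) = length (colouredNeighbours w ws) < length (L w) × GreedyOrder ws

    extendGreedily : (∀ x → Unique (L x)) → ∀ ws → Unique ws → GreedyOrder ws →
                     ∀ φ → IsLColoring G L (_∉ ws) φ → ∃ (Extends φ ws)

    extendWithColour : (∀ x → Unique (L x)) → ∀ {w ws c} φ → w ∉ ws → Unique ws →
                       GreedyOrder ws → IsLColoring G L (_∉ w ∷ ws) φ →
                       c ∈ L w → c ∉ map φ (colouredNeighbours w ws) →
                       ∃[ ψ ] Extends φ (w ∷ ws) ψ × ψ w ≡ c
    extendWithColour L-unique {w} {ws} {c} φ w∉ws ws-unique greedy col c∈L c-free
      with ψ , colψ , agree ← extendGreedily L-unique ws ws-unique greedy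
                                (updateAt φ w (const c)) (colourVertex w∉ws col c∈L c-free)
      = ψ , (colψ , λ x x∉ → trans (agree x (x∉ ∘ there)) (updateAt-minimal x w φ (x∉ ∘ here)))
          , trans (agree w w∉ws) (updateAt-updates w φ)

    extendGreedily L-unique [] _ _ φ col = φ , IsLColoring-mono (λ _ _ ()) col , λ _ _ → refl
    extendGreedily L-unique (w ∷ ws) (w∉ws ∷ ws-unique) (slack , greedy) φ col
      with c , c∈L , c-free ← freeColour ℕ._≟_ (L w) (map φ (colouredNeighbours w ws)) (L-unique w)
                                (≤-<-trans (≤-reflexive (length-map φ (colouredNeighbours w ws))) slack)
      with ψ , ext , _ ← extendWithColour L-unique φ (All¬⇒¬Any w∉ws) ws-unique greedy col c∈L c-free
      = ψ , ext

    TwoExtensions : (Fin n → ℕ) → List (Fin n) → Set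
    TwoExtensions φ ws = ∃[ ψ₁ ] ∃[ ψ₂ ]
      IsLColoring G L (λ _ → ⊤) ψ₁ × IsLColoring G L (λ _ → ⊤) ψ₂
      × (∀ x → x ∉ ws → ψ₁ x ≡ φ x) × (∀ x → x ∉ ws → ψ₂ x ≡ φ x)
      × ∃[ x ] ψ₁ x ≢ ψ₂ x

    twoExtensions : (∀ x → Unique (L x)) → ∀ w ws → w ∉ ws → Unique ws →
                    suc (length (colouredNeighbours w ws)) < length (L w) → GreedyOrder ws →
                    ∀ φ → IsLColoring G L (_∉ w ∷ ws) φ → TwoExtensions φ (w ∷ ws)
    twoExtensions L-unique w ws w∉ws ws-unique slack greedy φ col
      with c₁ , c₂ , c₁∈L , c₁-free , c₂∈L , c₂-free , c₁≢c₂
             ← twoFreeColours ℕ._≟_ (L w) (map φ (colouredNeighbours w ws)) (L-unique w)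
                 (≤-<-trans (s≤s (≤-reflexive (length-map φ (colouredNeighbours w ws)))) slack)
      with ψ₁ , (col₁ , agree₁) , ψ₁w≡c₁
             ← extendWithColour L-unique φ w∉ws ws-unique greedy col c₁∈L c₁-free
      with ψ₂ , (col₂ , agree₂) , ψ₂w≡c₂
             ← extendWithColour L-unique φ w∉ws ws-unique greedy col c₂∈L c₂-free
      = ψ₁ , ψ₂ , col₁ , col₂ , agree₁ , agree₂ ,
        (w , λ same → c₁≢c₂ (trans (sym ψ₁w≡c₁) (trans same ψ₂w≡c₂)))

    successor-uncoloured : ∀ {w} mid v → Linked (Edge G) (w ∷ mid ++ v ∷ []) →
                           length (colouredNeighbours w (mid ++ v ∷ [])) < degree G w
    successor-uncoloured []      v (e ∷ _) = length-colouredNeighbours-< (v ∷ []) (here refl) e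
    successor-uncoloured (m ∷ _) v (e ∷ _) = length-colouredNeighbours-< (m ∷ _) (here refl) e

    path-greedyOrder : ∀ mid v → Linked (Edge G) (mid ++ v ∷ []) →
                       All (λ x → degree G x ≤ length (L x)) mid → degree G v < length (L v) →
                       GreedyOrder (mid ++ v ∷ [])
    path-greedyOrder []        v _    []        deg-v =
      ≤-<-trans (length-colouredNeighbours-≤ v []) deg-v , tt
    path-greedyOrder (w ∷ mid) v path (deg-w ∷ deg-mid) deg-v =
      <-≤-trans (successor-uncoloured mid v path) deg-w ,
      path-greedyOrder mid v (Linked.tail path) deg-mid deg-v

    path-twoExtensions : (∀ x → Unique (L x)) → ∀ w mid v → IsPath G (w ∷ mid ++ v ∷ []) →
                         degree G w < length (L w) → All (λ x → degree G x ≤ length (L x)) mid →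
                         degree G v < length (L v) →
                         ∀ φ → IsLColoring G L (_∉ w ∷ mid ++ v ∷ []) φ →
                         TwoExtensions φ (w ∷ mid ++ v ∷ [])
    path-twoExtensions L-unique w mid v (w∉ ∷ unique , path) deg-w deg-mid deg-v =
      twoExtensions L-unique w (mid ++ v ∷ []) (All¬⇒¬Any w∉) unique
        (≤-<-trans (successor-uncoloured mid v path) deg-w)
        (path-greedyOrder mid v (Linked.tail path) deg-mid deg-v)

corollary2p10 : ∀ {n : ℕ} (G : Graph n) (H : Subgraph G) → Proper H →
    (v : Fin n) → ¬ V H v → degree G v ≡ 3 →
    (P : Stamen G H v) → ReducibleConfiguration G H (stamenSubgraph P)
corollary2p10 G H _ v v∉H deg-v P =
  (u P , here refl) ,
  (λ x → All.lookup (u∉H P ∷ ++⁺ (All.map proj₂ (internal P)) (v∉H ∷ []))) ,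
  λ L L≥4 → path-twoExtensions G L (proj₁ ∘ L≥4) (u P) (mid P) v (isPath P)
    (≤-trans (s≤s (≤-reflexive (deg-u P))) (proj₂ (L≥4 (u P))))
    (All.map (λ {x} (deg-x , _) → ≤-trans (≤-reflexive deg-x) (proj₂ (L≥4 x))) (internal P))
    (≤-trans (s≤s (≤-reflexive deg-v)) (proj₂ (L≥4 v)))
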